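{- Let $(B,\prec)$ be a compingent algebra such that $a\prec b$ implies there is $c\in B$ with $c\prec c$ and $a\prec c\prec b$. Let $\overline{B}$ be the MacNeille completion of $B$ (with $B$ identified as a Boolean subalgebra of $\overline B$), and define $\alpha\prec\beta$ on $\overline B$ iff there are $a,b\in B$ with $\alpha\le a\prec b\le\beta$. Then $(\overline{B},\prec)$ is a zerodimensional de Vries algebra.
   Context: A contact algebra is $(B,\prec)$ with $B$ Boolean and $\prec$ satisfying: $0\prec0$, $1\prec1$; $a\prec b,a\prec c\Rightarrow a\prec b\wedge c$; $a\prec c,b\prec c\Rightarrow a\vee b\prec c$; $a\le b\prec c\le d\Rightarrow a\prec d$; $a\prec b\Rightarrow a\le b$; $a\prec b\Rightarrow\neg b\prec\neg a$. It is compingent if also $a\prec b$ implies $a\prec c\prec b$ for some $c$, and $a\neq0$ implies $b\prec a$ for some $b\neq0$. A de Vries algebra is a compingent algebra whose Boolean algebra is complete; it is zerodimensional if $a\prec b$ implies there is $c$ with $c\prec c$ and $a\prec c\prec b$. -}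

module Defs where

open import Level using (Level; _⊔_; suc)
open import Data.Product using (Σ; _×_; ∃; ∃-syntax)
open import Relation.Nullary using (¬_)
open import Relation.Binary.Core using (Rel)
open import Algebra.Lattice.Bundles using (BooleanAlgebra)

private
  variable
    c ℓ c' ℓ' r : Level

module _ (B : BooleanAlgebra c ℓ) where
  open BooleanAlgebra B renaming (¬_ to ∁_)

  _≤ᴮ_ : Rel Carrier ℓ
  x ≤ᴮ y = (x ∧ y) ≈ x

  record IsContact (_≺_ : Rel Carrier r) : Set (c ⊔ ℓ ⊔ r) where
    field
      ≺-⊥   : ⊥ ≺ ⊥
      ≺-⊤   : ⊤ ≺ ⊤
      ≺-∧   : ∀ {a b d} → a ≺ b → a ≺ d → a ≺ (b ∧ d)
      ≺-∨   : ∀ {a b d} → a ≺ d → b ≺ d → (a ∨ b) ≺ d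
      ≺-mono : ∀ {a b d e} → a ≤ᴮ b → b ≺ d → d ≤ᴮ e → a ≺ e
      ≺⇒≤   : ∀ {a b} → a ≺ b → a ≤ᴮ b
      ≺-¬   : ∀ {a b} → a ≺ b → (∁ b) ≺ (∁ a)

  record IsCompingent (_≺_ : Rel Carrier r) : Set (c ⊔ ℓ ⊔ r) where
    field
      isContact     : IsContact _≺_
      interpolation : ∀ {a b} → a ≺ b → ∃[ d ] (a ≺ d × d ≺ b)
      nonzero       : ∀ {a} → ¬ (a ≈ ⊥) → ∃[ b ] (¬ (b ≈ ⊥) × b ≺ a)

  ZeroDimensional : (_≺_ : Rel Carrier r) → Set (c ⊔ r)
  ZeroDimensional _≺_ =
    ∀ {a b} → a ≺ b → ∃[ d ] (d ≺ d × a ≺ d × d ≺ b)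

  IsUpperBound : ∀ {p} → (Carrier → Set p) → Carrier → Set (c ⊔ ℓ ⊔ p)
  IsUpperBound P u = ∀ x → P x → x ≤ᴮ u

  IsSupremum : ∀ {p} → (Carrier → Set p) → Carrier → Set (c ⊔ ℓ ⊔ p)
  IsSupremum P s = IsUpperBound P s × (∀ u → IsUpperBound P u → s ≤ᴮ u)

  IsComplete : ∀ p → Set (c ⊔ ℓ ⊔ suc p)
  IsComplete p = (P : Carrier → Set p) → ∃[ s ] IsSupremum P s

  record IsDeVries (_≺_ : Rel Carrier r) : Set (suc c ⊔ ℓ ⊔ r) where
    field
      isCompingent : IsCompingent _≺_
      isComplete   : IsComplete c

  record IsZeroDimDeVries (_≺_ : Rel Carrier r) : Set (suc c ⊔ ℓ ⊔ r) where
    field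
      isDeVries       : IsDeVries _≺_
      zeroDimensional : ZeroDimensional _≺_

-- MacNeille completion of a Boolean algebra B: a complete Boolean
-- algebra C together with an embedding e : B → C of Boolean algebras
-- (injective homomorphism) whose image is join-dense and meet-dense
-- in C.  (This determines C up to isomorphism over B; via e, B is
-- identified with a Boolean subalgebra of C.)

module _ (B : BooleanAlgebra c ℓ) (C : BooleanAlgebra c' ℓ') where
  private
    module B = BooleanAlgebra B
    module C = BooleanAlgebra C

  record IsBooleanEmbedding (e : B.Carrier → C.Carrier)
         : Set (c ⊔ ℓ ⊔ c' ⊔ ℓ') where
    field
      cong      : ∀ {a b} → a B.≈ b → e a C.≈ e b
      injective : ∀ {a b} → e a C.≈ e b → a B.≈ b
      hom-∨     : ∀ a b → e (a B.∨ b) C.≈ (e a C.∨ e b)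
      hom-∧     : ∀ a b → e (a B.∧ b) C.≈ (e a C.∧ e b)
      hom-¬     : ∀ a → e (B.¬ a) C.≈ (C.¬ e a)
      hom-⊤     : e B.⊤ C.≈ C.⊤
      hom-⊥     : e B.⊥ C.≈ C.⊥

  record IsMacNeilleCompletion (e : B.Carrier → C.Carrier)
         : Set (c ⊔ ℓ ⊔ suc c' ⊔ ℓ') where
    field
      isEmbedding : IsBooleanEmbedding e
      isComplete  : IsComplete C c'
      -- every α is the join of the elements of B below it
      joinDense   : ∀ α γ → (∀ a → _≤ᴮ_ C (e a) α → _≤ᴮ_ C (e a) γ)
                          → _≤ᴮ_ C α γ
      -- every α is the meet of the elements of B above it
      meetDense   : ∀ α γ → (∀ a → _≤ᴮ_ C α (e a) → _≤ᴮ_ C γ (e a))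
                          → _≤ᴮ_ C γ α

  lift≺ : (e : B.Carrier → C.Carrier) → Rel B.Carrier r
        → Rel C.Carrier (c ⊔ ℓ' ⊔ r)
  lift≺ e _≺_ α β =
    ∃[ a ] ∃[ b ] (_≤ᴮ_ C α (e a) × a ≺ b × _≤ᴮ_ C (e b) β)

{-# OPTIONS --safe #-}
module Submission where

-- Every instance of the lifted relation on the completion is witnessed by
-- some a ≺ b in B, and the embedding preserves the Boolean operations, so the
-- contact axioms, interpolation and zerodimensionality pass from B to the
-- completion with the same witnesses.  Only the approximation axiom needs the
-- completion: by join density (and excluded middle) a nonzero α lies above
-- e a for some nonzero a ∈ B, and a nonzero b ≺ a in B then gives e b ≺ α.

open import Defs
open import Level using (Level; _⊔_; Lift; lift; lower)
open import Function.Base using (_∘_)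
open import Data.Product using (∃-syntax; _×_; _,_)
open import Relation.Nullary using (¬_)
open import Relation.Binary.Core using (Rel)
import Relation.Binary.Lattice.Bundles as Order
open import Algebra.Lattice.Bundles using (BooleanAlgebra)
open import Axiom.ExcludedMiddle using (ExcludedMiddle)
open import Axiom.DoubleNegationElimination
  using (DoubleNegationElimination; em⇒dne)

lowerDNE : ∀ {a} b → DoubleNegationElimination (a ⊔ b) → DoubleNegationElimination a
lowerDNE b dne ¬¬p = lower (dne {Lift b _} λ ¬p → ¬¬p (¬p ∘ lift))

module BooleanOrder {c ℓ} (B : BooleanAlgebra c ℓ) where
  open BooleanAlgebra B renaming (¬_ to ∁_)
  open import Algebra.Lattice.Properties.BooleanAlgebra B using (deMorgan₂; ∧-zeroʳ)
  open import Algebra.Lattice.Properties.Lattice lattice using (∨-∧-orderTheoreticLattice)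

  -- The library orders a lattice by  x ≈ x ∧ y,  the symmetric form of _≤ᴮ_.
  private
    module L = Order.Lattice ∨-∧-orderTheoreticLattice
  open import Relation.Binary.Lattice.Properties.MeetSemilattice L.meetSemilattice
    using (∧-monotonic)
  open import Relation.Binary.Lattice.Properties.JoinSemilattice L.joinSemilattice
    using (∨-monotonic; x≤y⇒x∨y≈y)

  infix 4 _≤_
  _≤_ : Rel Carrier ℓ
  _≤_ = _≤ᴮ_ B

  ≤-refl : ∀ {x} → x ≤ x
  ≤-refl = sym L.refl

  ≤-reflexive : ∀ {x y} → x ≈ y → x ≤ y
  ≤-reflexive x≈y = sym (L.reflexive x≈y)

  ≤-trans : ∀ {x y z} → x ≤ y → y ≤ z → x ≤ z
  ≤-trans x≤y y≤z = sym (L.trans (sym x≤y) (sym y≤z))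

  x∧y≤x : ∀ x y → x ∧ y ≤ x
  x∧y≤x x y = sym (L.x∧y≤x x y)

  x∧y≤y : ∀ x y → x ∧ y ≤ y
  x∧y≤y x y = sym (L.x∧y≤y x y)

  ∧-greatest : ∀ {x y z} → x ≤ y → x ≤ z → x ≤ y ∧ z
  ∧-greatest x≤y x≤z = sym (L.∧-greatest (sym x≤y) (sym x≤z))

  ∧-mono : ∀ {x y u v} → x ≤ y → u ≤ v → x ∧ u ≤ y ∧ v
  ∧-mono x≤y u≤v = sym (∧-monotonic (sym x≤y) (sym u≤v))

  x≤x∨y : ∀ x y → x ≤ x ∨ y
  x≤x∨y x y = sym (L.x≤x∨y x y)

  y≤x∨y : ∀ x y → y ≤ x ∨ y
  y≤x∨y x y = sym (L.y≤x∨y x y)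

  ∨-least : ∀ {x y z} → x ≤ z → y ≤ z → x ∨ y ≤ z
  ∨-least x≤z y≤z = sym (L.∨-least (sym x≤z) (sym y≤z))

  ∨-mono : ∀ {x y u v} → x ≤ y → u ≤ v → x ∨ u ≤ y ∨ v
  ∨-mono x≤y u≤v = sym (∨-monotonic (sym x≤y) (sym u≤v))

  ∁-antitone : ∀ {x y} → x ≤ y → ∁ y ≤ ∁ x
  ∁-antitone {x} {y} x≤y = begin
    ∁ y ∧ ∁ x  ≈⟨ deMorgan₂ y x ⟨
    ∁ (y ∨ x)  ≈⟨ ¬-cong (trans (∨-comm y x) (x≤y⇒x∨y≈y (sym x≤y))) ⟩
    ∁ y        ∎
    where open import Relation.Binary.Reasoning.Setoid setoid

  x≤⊥⇒x≈⊥ : ∀ {x} → x ≤ ⊥ → x ≈ ⊥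
  x≤⊥⇒x≈⊥ {x} x≤⊥ = trans (sym x≤⊥) (∧-zeroʳ x)

module Lifting {c ℓ c' ℓ' r}
  (B : BooleanAlgebra c ℓ) (C : BooleanAlgebra c' ℓ')
  {e : BooleanAlgebra.Carrier B → BooleanAlgebra.Carrier C}
  (isEmbedding : IsBooleanEmbedding B C e)
  (_≺_ : Rel (BooleanAlgebra.Carrier B) r)
  where

  private
    module B = BooleanAlgebra B
    module C = BooleanAlgebra C
    module B≤ = BooleanOrder B
    module C≤ = BooleanOrder C
    module e = IsBooleanEmbedding isEmbedding

  open B≤ using (_≤_)
  open C≤ using () renaming (_≤_ to _⊑_)

  infix 4 _≺̂_
  _≺̂_ : Rel C.Carrier (c ⊔ ℓ' ⊔ r)
  _≺̂_ = lift≺ B C e _≺_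

  e-mono : ∀ {a b} → a ≤ b → e a ⊑ e b
  e-mono {a} {b} a≤b = C.trans (C.sym (e.hom-∧ a b)) (e.cong a≤b)

  e≈⊥⇒≈⊥ : ∀ {a} → e a C.≈ C.⊥ → a B.≈ B.⊥
  e≈⊥⇒≈⊥ ea≈⊥ = e.injective (C.trans ea≈⊥ (C.sym e.hom-⊥))

  ≈⊥⇒e≈⊥ : ∀ {a} → a B.≈ B.⊥ → e a C.≈ C.⊥
  ≈⊥⇒e≈⊥ a≈⊥ = C.trans (e.cong a≈⊥) e.hom-⊥

  e-preserves-≺ : ∀ {a b} → a ≺ b → e a ≺̂ e b
  e-preserves-≺ {a} {b} a≺b = a , b , C≤.≤-refl , a≺b , C≤.≤-refl

  lift≺-isContact : IsContact B _≺_ → IsContact C _≺̂_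
  lift≺-isContact isContact = record
    { ≺-⊥    = B.⊥ , B.⊥ , C≤.≤-reflexive (C.sym e.hom-⊥) , ≺-⊥
             , C≤.≤-reflexive e.hom-⊥
    ; ≺-⊤    = B.⊤ , B.⊤ , C≤.≤-reflexive (C.sym e.hom-⊤) , ≺-⊤
             , C≤.≤-reflexive e.hom-⊤
    ; ≺-∧    = meet
    ; ≺-∨    = join
    ; ≺-mono = λ α⊑β (a , b , β⊑a , a≺b , b⊑γ) γ⊑δ →
        a , b , C≤.≤-trans α⊑β β⊑a , a≺b , C≤.≤-trans b⊑γ γ⊑δ
    ; ≺⇒≤    = λ (a , b , α⊑a , a≺b , b⊑β) →
        C≤.≤-trans α⊑a (C≤.≤-trans (e-mono (≺⇒≤ a≺b)) b⊑β)
    ; ≺-¬    = λ (a , b , α⊑a , a≺b , b⊑β) →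
        B.¬ b , B.¬ a
        , C≤.≤-trans (C≤.∁-antitone b⊑β) (C≤.≤-reflexive (C.sym (e.hom-¬ b)))
        , ≺-¬ a≺b
        , C≤.≤-trans (C≤.≤-reflexive (e.hom-¬ a)) (C≤.∁-antitone α⊑a)
    }
    where
    open IsContact isContact

    meet : ∀ {α β γ} → α ≺̂ β → α ≺̂ γ → α ≺̂ β C.∧ γ
    meet (a , b , α⊑a , a≺b , b⊑β) (a' , b' , α⊑a' , a'≺b' , b'⊑γ) =
      a B.∧ a' , b B.∧ b'
      , C≤.≤-trans (C≤.∧-greatest α⊑a α⊑a') (C≤.≤-reflexive (C.sym (e.hom-∧ a a')))
      , ≺-∧ (≺-mono (B≤.x∧y≤x a a') a≺b B≤.≤-refl)
            (≺-mono (B≤.x∧y≤y a a') a'≺b' B≤.≤-refl)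
      , C≤.≤-trans (C≤.≤-reflexive (e.hom-∧ b b')) (C≤.∧-mono b⊑β b'⊑γ)

    join : ∀ {α β γ} → α ≺̂ γ → β ≺̂ γ → α C.∨ β ≺̂ γ
    join (a , b , α⊑a , a≺b , b⊑γ) (a' , b' , β⊑a' , a'≺b' , b'⊑γ) =
      a B.∨ a' , b B.∨ b'
      , C≤.≤-trans (C≤.∨-mono α⊑a β⊑a') (C≤.≤-reflexive (C.sym (e.hom-∨ a a')))
      , ≺-∨ (≺-mono B≤.≤-refl a≺b (B≤.x≤x∨y b b'))
            (≺-mono B≤.≤-refl a'≺b' (B≤.y≤x∨y b b'))
      , C≤.≤-trans (C≤.≤-reflexive (e.hom-∨ b b')) (C≤.∨-least b⊑γ b'⊑γ)

  lift≺-interpolation : (∀ {a b} → a ≺ b → ∃[ d ] (a ≺ d × d ≺ b))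
                      → ∀ {α β} → α ≺̂ β → ∃[ δ ] (α ≺̂ δ × δ ≺̂ β)
  lift≺-interpolation interpolation (a , b , α⊑a , a≺b , b⊑β) =
    let d , a≺d , d≺b = interpolation a≺b
    in e d , (a , d , α⊑a , a≺d , C≤.≤-refl) , (d , b , C≤.≤-refl , d≺b , b⊑β)

  lift≺-zeroDimensional : ZeroDimensional B _≺_ → ZeroDimensional C _≺̂_
  lift≺-zeroDimensional zeroDimensional (a , b , α⊑a , a≺b , b⊑β) =
    let d , d≺d , a≺d , d≺b = zeroDimensional a≺b
    in e d , e-preserves-≺ d≺d
       , (a , d , α⊑a , a≺d , C≤.≤-refl) , (d , b , C≤.≤-refl , d≺b , b⊑β)

  IsJoinDense : Set (c ⊔ c' ⊔ ℓ')
  IsJoinDense = ∀ α γ → (∀ a → e a ⊑ α → e a ⊑ γ) → α ⊑ γ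

  module _ (joinDense : IsJoinDense)
           (dne : DoubleNegationElimination (c ⊔ ℓ ⊔ ℓ'))
           where

    nonzero-above-embedded-nonzero : ∀ {α} → ¬ α C.≈ C.⊥
                                   → ∃[ a ] (¬ a B.≈ B.⊥ × e a ⊑ α)
    nonzero-above-embedded-nonzero {α} α≉⊥ = dne λ none →
      α≉⊥ (C≤.x≤⊥⇒x≈⊥ (joinDense α C.⊥ λ a ea⊑α →
        C≤.≤-reflexive (lowerDNE (c ⊔ ℓ) dne λ ea≉⊥ →
          none (a , ea≉⊥ ∘ ≈⊥⇒e≈⊥ , ea⊑α))))

    lift≺-nonzero : (∀ {a} → ¬ a B.≈ B.⊥ → ∃[ b ] (¬ b B.≈ B.⊥ × b ≺ a))
                  → ∀ {α} → ¬ α C.≈ C.⊥ → ∃[ β ] (¬ β C.≈ C.⊥ × β ≺̂ α)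
    lift≺-nonzero nonzero α≉⊥ =
      let a , a≉⊥ , ea⊑α = nonzero-above-embedded-nonzero α≉⊥
          b , b≉⊥ , b≺a  = nonzero a≉⊥
      in e b , b≉⊥ ∘ e≈⊥⇒≈⊥ , (b , a , C≤.≤-refl , b≺a , ea⊑α)

    lift≺-isCompingent : IsCompingent B _≺_ → IsCompingent C _≺̂_
    lift≺-isCompingent isCompingent = record
      { isContact     = lift≺-isContact isContact
      ; interpolation = lift≺-interpolation interpolation
      ; nonzero       = lift≺-nonzero nonzero
      }
      where open IsCompingent isCompingent

proposition4p18 : ∀ {c ℓ c' ℓ' r : Level}
    → ExcludedMiddle (c ⊔ ℓ ⊔ c' ⊔ ℓ' ⊔ r)
    → (B : BooleanAlgebra c ℓ) (_≺_ : Rel (BooleanAlgebra.Carrier B) r)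
    → IsCompingent B _≺_
    → ZeroDimensional B _≺_
    → (C : BooleanAlgebra c' ℓ') (e : BooleanAlgebra.Carrier B → BooleanAlgebra.Carrier C)
    → IsMacNeilleCompletion B C e
    → IsZeroDimDeVries C (lift≺ B C e _≺_)
proposition4p18 {c} {ℓ} {c'} {ℓ'} {r} em B _≺_ isCompingent zeroDimensional C e isMacNeille =
  record
    { isDeVries = record
      { isCompingent = lift≺-isCompingent joinDense dne isCompingent
      ; isComplete   = isComplete
      }
    ; zeroDimensional = lift≺-zeroDimensional zeroDimensional
    }
  where
  open IsMacNeilleCompletion isMacNeille
  open Lifting B C isEmbedding _≺_

  dne : DoubleNegationElimination (c ⊔ ℓ ⊔ ℓ')
  dne = lowerDNE (c ⊔ ℓ ⊔ c' ⊔ ℓ' ⊔ r) (em⇒dne em)
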